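{- Let $0\le m\le n$, let $\lambda\subseteq\rho_n$ be a strict partition, and let $T\in\mathsf{SELT}(\rho_n/\lambda,|\rho_{n,m}|)$. If there exist $\ell'<\ell$ and a label $j$ with $j\in\mathsf{col}_\ell(S_{\rho_{n,m}})\cap\mathsf{col}_{\ell'}(T)$, then $\mathrm{Rect}(T)\neq S_{\rho_{n,m}}$.
   Context: Strict partitions $\lambda$ are identified with shifted diagrams: row $i$ (from top) has $\lambda_i$ boxes and is indented $i-1$ units; boxes are $(i,j)$ in matrix coordinates. $\rho_n=(n,n-1,\ldots,1)$, $\rho_{n,m}=(n,n-1,\ldots,n-m+1)$. The diagonal edges of $\nu/\lambda$ are the southern edges of the diagonal boxes $(i,i)$ of $\nu$. A shifted edge labeled tableau of shape $\nu/\lambda$ with labels $[N]$: each box of $\nu/\lambda$ gets exactly one label, each diagonal edge gets a (possibly empty) set of labels, each $i\in[N]$ appears exactly once, labels strictly increase along rows (west to east) and down columns, and each label on a diagonal edge is larger than any label directly north of it. The set is $\mathsf{SELT}(\nu/\lambda,N)$. For such $T$, $T(i,j)$ is the entry in box $(i,j)$, $E_i(T)$ is the set of labels on the $i$-th diagonal edge of $\nu$, and $\mathsf{col}_k(T)=E_k(T)\cup\{T(i,k):(i,k)\in\nu/\lambda\}$. Jeu de taquin: an inner corner $\mathsf c$ is a box of $\lambda$ with no box of $\lambda$ immediately east or south. $\mathsf{jdt}_{\mathsf c}(T)$: place $\bullet$ in $\mathsf c$ and repeatedly apply: (1) with $a$ east and $b$ south of $\bullet$, if $b<a$ (or $a$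 absent) swap $\bullet,b$; (2) if $a<b$ (or $b$ absent) swap $\bullet,a$; (3) if $\bullet$ is in a diagonal box with $a$ east and edge set $S$ below, and $a<\min S$ or $S=\emptyset$, swap $\bullet,a$; (4) if $s=\min S<a$ (or $a$ absent), put $s$ in the box of $\bullet$, remove $s$ from $S$, and stop. Also stop when nothing lies directly south or east of $\bullet$. Then remove $\bullet$ (and its box from the shape). $\mathrm{Rect}(T)$: apply $\mathsf{jdt}$ at a southmost inner corner of the current shape repeatedly, $|\lambda|$ times, yielding a straight-shape tableau. $S_\mu$ is the superstandard tableau of shape $\mu$, filling $\mu$ with $1,\ldots,|\mu|$ row by row in English reading order; for it $\mathsf{col}_k(S_\mu)$ is the set of entries of column $k$. -}

module Defs where

open import Data.Nat using (ℕ; zero; suc; _+_; _*_; _∸_; _≤_; _<_; _≡ᵇ_; _<ᵇ_; _≤ᵇ_)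
open import Data.Bool using (Bool; true; false; _∧_; not; if_then_else_)
open import Data.Maybe using (Maybe; just; nothing)
open import Data.List using (List; []; _∷_; length; take; filterᵇ)
open import Data.Nat.ListAction using (sum)
open import Data.List.Membership.Propositional using (_∈_)
open import Data.List.Relation.Unary.All using (All)
open import Data.List.Relation.Unary.Linked using (Linked)
open import Data.List.Relation.Unary.Unique.Propositional using (Unique)
open import Data.Product using (_×_; ∃; Σ)
open import Data.Sum using (_⊎_)
open import Relation.Binary.PropositionalEquality using (_≡_)
open import Relation.Nullary using (¬_)

StrictPartition : List ℕ → Set
StrictPartition lam = Linked (λ a b → b < a) lam × All (λ a → 0 < a) lam

-- rowLen lam i = lam_i (rows indexed from 1; 0 outside)
rowLen : List ℕ → ℕ → ℕ
rowLen [] _ = 0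
rowLen (x ∷ xs) zero = 0
rowLen (x ∷ xs) (suc zero) = x
rowLen (x ∷ xs) (suc (suc i)) = rowLen xs (suc i)

inShᵇ : List ℕ → ℕ → ℕ → Bool
inShᵇ lam i j = (1 ≤ᵇ i) ∧ ((i ≤ᵇ j) ∧ (j <ᵇ i + rowLen lam i))

InSh : List ℕ → ℕ → ℕ → Set
InSh lam i j = inShᵇ lam i j ≡ true

_⊆ₛ_ : List ℕ → List ℕ → Set
lam ⊆ₛ nu = ∀ i j → InSh lam i j → InSh nu i j

InSkew : List ℕ → List ℕ → ℕ → ℕ → Set
InSkew nu lam i j = InSh nu i j × ¬ InSh lam i j

rho : ℕ → List ℕ
rho zero = []
rho (suc n) = suc n ∷ rho n

rhoNM : ℕ → ℕ → List ℕ
rhoNM n m = take m (rho n)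

-- Shifted edge labeled tableaux (raw data)
-- ent i j  : entry of box (i,j), or nothing if (i,j) is not a box of the skew shape
-- edge i   : labels on the southern edge of diagonal box (i,i) (a list used as a set)

record Tab : Set where
  field
    ent  : ℕ → ℕ → Maybe ℕ
    edge : ℕ → List ℕ
open Tab public

data Pos : Set where
  box : ℕ → ℕ → Pos
  edg : ℕ → Pos

OccAt : Tab → ℕ → Pos → Set
OccAt t a (box i j) = ent t i j ≡ just a
OccAt t a (edg i) = a ∈ edge t i

record SELT (nu lam : List ℕ) (N : ℕ) (t : Tab) : Set where
  field
    boxesIn     : ∀ i j → InSkew nu lam i j → ∃ λ a → ent t i j ≡ just a
    boxesOut    : ∀ i j → ¬ InSkew nu lam i j → ent t i j ≡ nothing
    edgesOut    : ∀ i → ¬ InSh nu i i → edge t i ≡ []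
    edgesSet    : ∀ i → Unique (edge t i)
    labelsRange : ∀ a p → OccAt t a p → (1 ≤ a × a ≤ N)
    labelsOnce  : ∀ a → 1 ≤ a → a ≤ N →
                  Σ Pos λ p → OccAt t a p × (∀ q → OccAt t a q → q ≡ p)
    rowsInc     : ∀ i j j' a b → j < j' → ent t i j ≡ just a → ent t i j' ≡ just b → a < b
    colsInc     : ∀ i i' j a b → i < i' → ent t i j ≡ just a → ent t i' j ≡ just b → a < b
    edgeNorth   : ∀ i k a b → k ≤ i → ent t k i ≡ just a → b ∈ edge t i → a < b

InCol : ℕ → ℕ → Tab → Set
InCol a k t = (a ∈ edge t k) ⊎ (∃ λ i → ent t i k ≡ just a)

TabEq : Tab → Tab → Set
TabEq t u = (∀ i j → ent t i j ≡ ent u i j) × (∀ i a → (a ∈ edge t i → a ∈ edge u i) × (a ∈ edge u i → a ∈ edge t i))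

-- Superstandard tableau S_mu: fill rows with 1..|mu| in reading order, no edge labels

superstd : List ℕ → Tab
superstd mu = record
  { ent  = λ i j → if inShᵇ mu i j then just (sum (take (i ∸ 1) mu) + (j ∸ i) + 1) else nothing
  ; edge = λ _ → [] }

setEnt : (ℕ → ℕ → Maybe ℕ) → ℕ → ℕ → Maybe ℕ → (ℕ → ℕ → Maybe ℕ)
setEnt f i j v i' j' = if (i' ≡ᵇ i) ∧ (j' ≡ᵇ j) then v else f i' j'

-- the bullet at (i,j) swaps with the label v at (i',j'): v goes to (i,j), bullet to (i',j')
move : Tab → ℕ → ℕ → ℕ → ℕ → ℕ → Tab
move t i j i' j' v = record
  { ent  = setEnt (setEnt (ent t) i j (just v)) i' j' nothing
  ; edge = edge t }

-- rule (4): the minimal label s of edge i goes into the diagonal box (i,i)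
placeEdge : Tab → ℕ → ℕ → Tab
placeEdge t i s = record
  { ent  = setEnt (ent t) i i (just s)
  ; edge = λ k → if k ≡ᵇ i then filterᵇ (λ x → not (x ≡ᵇ s)) (edge t k) else edge t k }

minL : List ℕ → Maybe ℕ
minL [] = nothing
minL (x ∷ xs) with minL xs
... | nothing = just x
... | just y = if x <ᵇ y then just x else just y

-- slide the bullet located at (i,j) (whose cell holds no label) with fuel f;
-- when it stops, the bullet's cell is left empty (i.e. removed from the shape)
slide : ℕ → ℕ → ℕ → Tab → Tab
slide zero i j t = t
slide (suc f) i j t with i ≡ᵇ j
slide (suc f) i j t | true with ent t i (suc j) | minL (edge t i)
... | nothing | nothing = t
... | nothing | just s  = placeEdge t i s
... | just a  | nothing = slide f i (suc j) (move t i j i (suc j) a)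
... | just a  | just s  = if s <ᵇ a then placeEdge t i s
                          else slide f i (suc j) (move t i j i (suc j) a)
slide (suc f) i j t | false with ent t i (suc j) | ent t (suc i) j
... | nothing | nothing = t
... | nothing | just b  = slide f (suc i) j (move t i j (suc i) j b)
... | just a  | nothing = slide f i (suc j) (move t i j i (suc j) a)
... | just a  | just b  = if b <ᵇ a then slide f (suc i) j (move t i j (suc i) j b)
                          else slide f i (suc j) (move t i j i (suc j) a)

-- southmost inner corner of a strict partition lam = last box of its last row
cornerRow : List ℕ → ℕ
cornerRow lam = length lam

cornerCol : List ℕ → ℕ
cornerCol lam = length lam + rowLen lam (length lam) ∸ 1

decLast : List ℕ → List ℕ
decLast [] = []
decLast (x ∷ []) = if x ≤ᵇ 1 then [] else (x ∸ 1 ∷ [])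
decLast (x ∷ y ∷ ys) = x ∷ decLast (y ∷ ys)

jdt : ℕ → List ℕ → Tab → Tab
jdt f lam t = slide f (cornerRow lam) (cornerCol lam) t

rectAux : ℕ → ℕ → List ℕ → Tab → Tab
rectAux f zero lam t = t
rectAux f (suc k) lam t = rectAux f k (decLast lam) (jdt f lam t)

-- Rect(T) for T of inner shape lam, applying jdt |lam| times;
-- f bounds the number of steps of each slide (2n+2 suffices inside ρ_n)
rect : ℕ → List ℕ → Tab → Tab
rect f lam t = rectAux f (sum lam) lam t

-- Every jeu de taquin move sends a label to the same column or one further east:
-- a box label slides west only when the bullet trails it to the east or south, and an
-- edge label only ever enters the diagonal box of its own column. Hence a label in
-- column ℓ of Rect(T) sat in column ≥ ℓ of T. Since every label occurs exactly once in
-- T, a label of column ℓ of S_{ρ_{n,m}} seen in column ℓ' < ℓ of T rules out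
-- Rect(T) = S_{ρ_{n,m}}.
module Submission where

open import Defs
open import Data.Nat using (ℕ; _≤_; _<_; _+_; _*_; suc; zero; _≡ᵇ_; _<ᵇ_)
open import Data.Nat.Properties using (≤-refl; ≤-trans; n≤1+n; <⇒≱; ≡ᵇ⇒≡)
open import Data.Bool using (true; false; _∧_; not; T?)
open import Data.Bool.Properties using (T-≡; T-∧)
open import Data.Maybe using (just; nothing)
open import Data.Maybe.Properties using (just-injective)
open import Data.List using (List; _∷_)
open import Data.List.Membership.Propositional using (_∈_)
open import Data.List.Membership.Propositional.Properties using (∈-filter⁻)
open import Data.List.Relation.Unary.Any using (here; there)
open import Data.Nat.ListAction using (sum)
open import Data.Product using (_×_; ∃; Σ; _,_; proj₁; proj₂)
open import Data.Sum using (_⊎_; inj₁; inj₂)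
open import Function using (_∘_; Equivalence)
open import Relation.Nullary using (¬_)
open import Relation.Binary.PropositionalEquality using (_≡_; refl; sym; trans; subst)

MovesEast : Tab → Tab → Set
MovesEast t u = ∀ a k → InCol a k u → ∃ λ k' → k ≤ k' × InCol a k' t

movesEast-refl : ∀ {t} → MovesEast t t
movesEast-refl a k a∈k = k , ≤-refl , a∈k

movesEast-trans : ∀ {t u v} → MovesEast t u → MovesEast u v → MovesEast t v
movesEast-trans t⇝u u⇝v a k a∈v with u⇝v a k a∈v
... | k₁ , k≤k₁ , a∈u with t⇝u a k₁ a∈u
... | k₂ , k₁≤k₂ , a∈t = k₂ , ≤-trans k≤k₁ k₁≤k₂ , a∈t

setEnt-just : ∀ f i j v r k {a} → setEnt f i j v r k ≡ just a →
              (r ≡ i × k ≡ j × v ≡ just a) ⊎ f r k ≡ just a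
setEnt-just f i j v r k e with (r ≡ᵇ i) ∧ (k ≡ᵇ j) in hit
... | false = inj₂ e
... | true with T-∧ {r ≡ᵇ i} {k ≡ᵇ j} .Equivalence.to (T-≡ .Equivalence.from hit)
...   | r≡ᵇi , k≡ᵇj = inj₁ (≡ᵇ⇒≡ r i r≡ᵇi , ≡ᵇ⇒≡ k j k≡ᵇj , e)

move-movesEast : ∀ t i j i' j' v → ent t i' j' ≡ just v → j ≤ j' →
                 MovesEast t (move t i j i' j' v)
move-movesEast t i j i' j' v v∈i'j' j≤j' a k (inj₁ a∈edge) = k , ≤-refl , inj₁ a∈edge
move-movesEast t i j i' j' v v∈i'j' j≤j' a k (inj₂ (r , e))
  with setEnt-just (setEnt (ent t) i j (just v)) i' j' nothing r k e
... | inj₁ (_ , _ , ())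
... | inj₂ e' with setEnt-just (ent t) i j (just v) r k e'
...   | inj₁ (_ , refl , v≡a) = j' , j≤j' , inj₂ (i' , trans v∈i'j' v≡a)
...   | inj₂ e'' = k , ≤-refl , inj₂ (r , e'')

placeEdge-edge⊆ : ∀ t i s k {a} → a ∈ edge (placeEdge t i s) k → a ∈ edge t k
placeEdge-edge⊆ t i s k a∈ with k ≡ᵇ i
... | true  = proj₁ (∈-filter⁻ (T? ∘ (λ x → not (x ≡ᵇ s))) {xs = edge t k} a∈)
... | false = a∈

placeEdge-movesEast : ∀ t i s → s ∈ edge t i → MovesEast t (placeEdge t i s)
placeEdge-movesEast t i s s∈i a k (inj₁ a∈edge) = k , ≤-refl , inj₁ (placeEdge-edge⊆ t i s k a∈edge)
placeEdge-movesEast t i s s∈i a k (inj₂ (r , e)) with setEnt-just (ent t) i i (just s) r k e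
... | inj₁ (_ , refl , s≡a) = k , ≤-refl , inj₁ (subst (_∈ edge t k) (just-injective s≡a) s∈i)
... | inj₂ e' = k , ≤-refl , inj₂ (r , e')

minL-∈ : ∀ xs {s} → minL xs ≡ just s → s ∈ xs
minL-∈ (x ∷ xs) e with minL xs in m
... | nothing = here (sym (just-injective e))
... | just y with x <ᵇ y
...   | true  = here (sym (just-injective e))
...   | false with just-injective e
...     | refl = there (minL-∈ xs m)

slide-movesEast : ∀ f i j t → MovesEast t (slide f i j t)

slideEast-movesEast : ∀ f i j t {a} → ent t i (suc j) ≡ just a →
                      MovesEast t (slide f i (suc j) (move t i j i (suc j) a))
slideEast-movesEast f i j t a∈ =
  movesEast-trans (move-movesEast t i j i (suc j) _ a∈ (n≤1+n j)) (slide-movesEast f i (suc j) _)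

slideSouth-movesEast : ∀ f i j t {b} → ent t (suc i) j ≡ just b →
                       MovesEast t (slide f (suc i) j (move t i j (suc i) j b))
slideSouth-movesEast f i j t b∈ =
  movesEast-trans (move-movesEast t i j (suc i) j _ b∈ ≤-refl) (slide-movesEast f (suc i) j _)

slide-movesEast zero i j t = movesEast-refl
slide-movesEast (suc f) i j t with i ≡ᵇ j
slide-movesEast (suc f) i j t | true with ent t i (suc j) in ea | minL (edge t i) in es
... | nothing | nothing = movesEast-refl
... | nothing | just s  = placeEdge-movesEast t i s (minL-∈ _ es)
... | just a  | nothing = slideEast-movesEast f i j t ea
... | just a  | just s with s <ᵇ a
...   | true  = placeEdge-movesEast t i s (minL-∈ _ es)
...   | false = slideEast-movesEast f i j t ea
slide-movesEast (suc f) i j t | false with ent t i (suc j) in ea | ent t (suc i) j in eb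
... | nothing | nothing = movesEast-refl
... | nothing | just b  = slideSouth-movesEast f i j t eb
... | just a  | nothing = slideEast-movesEast f i j t ea
... | just a  | just b with b <ᵇ a
...   | true  = slideSouth-movesEast f i j t eb
...   | false = slideEast-movesEast f i j t ea

rectAux-movesEast : ∀ f k lam t → MovesEast t (rectAux f k lam t)
rectAux-movesEast f zero lam t = movesEast-refl
rectAux-movesEast f (suc k) lam t =
  movesEast-trans (slide-movesEast f _ _ t) (rectAux-movesEast f k (decLast lam) _)

rect-movesEast : ∀ f lam t → MovesEast t (rect f lam t)
rect-movesEast f lam = rectAux-movesEast f (sum lam) lam

column : Pos → ℕ
column (box i j) = j
column (edg i)   = i

InCol⇒OccAt : ∀ {t a k} → InCol a k t → Σ Pos λ p → OccAt t a p × column p ≡ k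
InCol⇒OccAt {k = k} (inj₁ a∈edge) = edg k , a∈edge , refl
InCol⇒OccAt {k = k} (inj₂ (i , e)) = box i k , e , refl

InCol-unique : ∀ {nu lam N t} → SELT nu lam N t →
               ∀ {a k k'} → InCol a k t → InCol a k' t → k ≡ k'
InCol-unique S {a} {k} {k'} a∈k a∈k' with InCol⇒OccAt {k = k} a∈k | InCol⇒OccAt {k = k'} a∈k'
... | p , atP , refl | q , atQ , refl with SELT.labelsRange S a p atP
... | 1≤a , a≤N with SELT.labelsOnce S a 1≤a a≤N
... | _ , _ , once with once p atP | once q atQ
... | refl | refl = refl

InCol-resp-TabEq : ∀ {t u a k} → TabEq t u → InCol a k u → InCol a k t
InCol-resp-TabEq {k = k} (_ , sameEdges) (inj₁ a∈edge) = inj₁ (sameEdges k _ .proj₂ a∈edge)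
InCol-resp-TabEq {k = k} (sameEnts , _) (inj₂ (i , e)) = inj₂ (i , trans (sameEnts i k) e)

proposition3p2 : (n m : ℕ) → m ≤ n →
    (lam : List ℕ) → StrictPartition lam → lam ⊆ₛ rho n →
    (T : Tab) → SELT (rho n) lam (sum (rhoNM n m)) T →
    (∃ λ ℓ → ∃ λ ℓ' → ∃ λ j → ℓ' < ℓ × InCol j ℓ (superstd (rhoNM n m)) × InCol j ℓ' T) →
    ¬ TabEq (rect (2 * n + 2) lam T) (superstd (rhoNM n m))
proposition3p2 n m _ lam _ _ T S (ℓ , ℓ' , j , ℓ'<ℓ , j∈S , j∈T) rectT≈S
  with rect-movesEast (2 * n + 2) lam T j ℓ (InCol-resp-TabEq rectT≈S j∈S)
... | k , ℓ≤k , j∈Tk = <⇒≱ ℓ'<ℓ (subst (ℓ ≤_) (InCol-unique S j∈Tk j∈T) ℓ≤k)
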